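{- Let $f:\{0,1\}^n\to\{0,1\}^n$ be a Boolean network with signed interaction graph $(G,\sigma)$. Then the number of fixed points of $f$ is at most the sum of the $\nu^++1$ largest binomial coefficients $\binom{\tau^*_m}{k}$ ($0\le k\le\tau^*_m$), where $\nu^+=\nu^+(G,\sigma)$ and $\tau^*_m=\tau^*_m(G,\sigma)$.
   Context: The interaction graph $G$ of $f$ has vertex set $[n]$ and an arc $uv$ (loops allowed) iff $f_v$ depends on $x_u$. The signed interaction graph is $(G,\sigma)$ with, for each arc $uv$: $\sigma(uv)=1$ if $f_v(x)\le f_v(x+e_u)$ for all $x$ with $x_u=0$; $\sigma(uv)=-1$ if $f_v(x)\ge f_v(x+e_u)$ for all $x$ with $x_u=0$; $\sigma(uv)=0$ otherwise ($e_u$ is the $u$-th unit vector). Cycles are directed without repeated vertices; the sign of a cycle is the product of the signs of its arcs; $\nu^+$ is the maximum number of vertex-disjoint cycles of non-negative sign. For a vertex set $I$, the $I$-switch $\sigma^I$ is given by $\sigma^I(uv)=\sigma(uv)$ if $u,v\in I$ or $u,v\notin I$, and $\sigma^I(uv)=-\sigma(uv)$ otherwise. A monotone feedback vertex set of $(G,\sigma)$ is a set $J$ meeting every cycle of $G$ such that $\sigma(uv)=1$ for every arc $uv$ with $v\notin J$; $\tau_m(G,\sigma)$ is its minimum size, and $\tau^*_m(G,\sigma)=\min_{I}\tau_m(G,\sigma^I)$ over all vertex sets $I$. -}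

module Defs where

open import Level using (Level)
open import Data.Bool using (Bool; true; false; not; if_then_else_; _xor_)
import Data.Bool as B
open import Data.Bool.Properties using () renaming (_≤?_ to _≤B?_)
open import Data.Nat using (ℕ; zero; suc; _≤_)
open import Data.Nat.Properties using (≤-decTotalOrder)
open import Data.Nat.Combinatorics using (_C_)
open import Data.Integer using (ℤ; 0ℤ; 1ℤ; -_; _*_) renaming (_≤_ to _≤ℤ_)
open import Data.Fin using (Fin)
open import Data.Fin.Subset using (Subset; ∣_∣) renaming (_∈_ to _∈ₛ_; _∉_ to _∉ₛ_)
open import Data.Vec using (Vec; []; _∷_; lookup; _[_]≔_; _[_]%=_)
open import Data.Vec.Properties using (≡-dec)
open import Data.List using (List; []; _∷_; [_]; _++_; map; filter; length; foldr; take; reverse; upTo)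
open import Data.List.Membership.Propositional using (_∈_; _∉_)
open import Data.List.Relation.Unary.All using (All)
open import Data.List.Relation.Unary.Any using (Any)
open import Data.List.Relation.Unary.AllPairs using (AllPairs)
open import Data.List.Relation.Unary.Unique.Propositional using (Unique)
open import Data.Product using (Σ; ∃; _×_; _,_)
open import Relation.Nullary using (Dec; yes; no; ¬_; does)
open import Relation.Nullary.Decidable using (_→-dec_)
open import Relation.Binary.PropositionalEquality using (_≡_; _≢_; refl)
import Data.List.Sort as Sort
open import Data.Nat.ListAction using (sum)

-- Boolean networks: f : {0,1}^n → {0,1}^n, configurations as Vec Bool n.
-- The local function f_v(x) is  lookup (f x) v.

Config : ℕ → Set
Config n = Vec Bool n

BN : ℕ → Set
BN n = Config n → Config n

allConfigs : (n : ℕ) → List (Config n)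
allConfigs zero = [ [] ]
allConfigs (suc n) = map (false ∷_) (allConfigs n) ++ map (true ∷_) (allConfigs n)

numFixedPoints : {n : ℕ} → BN n → ℕ
numFixedPoints {n} f = length (filter (λ x → ≡-dec B._≟_ (f x) x) (allConfigs n))

-- Interaction graph: arc uv iff f_v depends on x_u.

Arc : {n : ℕ} → BN n → Fin n → Fin n → Set
Arc f u v = ∃ λ x → lookup (f x) v ≢ lookup (f (x [ u ]%= not)) v

allConfigs? : (n : ℕ) {P : Config n → Set} → (∀ x → Dec (P x)) → Dec (∀ x → P x)
allConfigs? zero P? with P? []
... | yes p = yes λ { [] → p }
... | no ¬p = no λ h → ¬p (h [])
allConfigs? (suc n) P? with allConfigs? n (λ xs → P? (false ∷ xs)) | allConfigs? n (λ xs → P? (true ∷ xs))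
... | yes a | yes b = yes λ { (false ∷ xs) → a xs ; (true ∷ xs) → b xs }
... | no ¬a | _ = no λ h → ¬a (λ xs → h (false ∷ xs))
... | yes _ | no ¬b = no λ h → ¬b (λ xs → h (true ∷ xs))

Increasing : {n : ℕ} → BN n → Fin n → Fin n → Set
Increasing f u v = ∀ x → lookup x u ≡ false → lookup (f x) v B.≤ lookup (f (x [ u ]≔ true)) v

Decreasing : {n : ℕ} → BN n → Fin n → Fin n → Set
Decreasing f u v = ∀ x → lookup x u ≡ false → lookup (f (x [ u ]≔ true)) v B.≤ lookup (f x) v

increasing? : {n : ℕ} (f : BN n) (u v : Fin n) → Dec (Increasing f u v)
increasing? {n} f u v = allConfigs? n (λ x → (lookup x u B.≟ false) →-dec (lookup (f x) v ≤B? lookup (f (x [ u ]≔ true)) v))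

decreasing? : {n : ℕ} (f : BN n) (u v : Fin n) → Dec (Decreasing f u v)
decreasing? {n} f u v = allConfigs? n (λ x → (lookup x u B.≟ false) →-dec (lookup (f (x [ u ]≔ true)) v ≤B? lookup (f x) v))

-- Signing: σ(uv) ∈ {1, -1, 0} (only meaningful on arcs of G;
-- on an arc, Increasing and Decreasing cannot both hold).
Signing : ℕ → Set
Signing n = Fin n → Fin n → ℤ

sign : {n : ℕ} → BN n → Signing n
sign f u v with does (increasing? f u v) | does (decreasing? f u v)
... | true  | _     = 1ℤ
... | false | true  = - 1ℤ
... | false | false = 0ℤ

switch : {n : ℕ} → Subset n → Signing n → Signing n
switch I σ u v = if lookup I u xor lookup I v then - σ u v else σ u v

-- Cycles: a nonempty list of distinct vertices v₀ … v_{k-1} with arcs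
-- v₀v₁, …, v_{k-2}v_{k-1}, v_{k-1}v₀ (k = 1 gives a loop).

walkArcs : {n : ℕ} → Fin n → Fin n → List (Fin n) → List (Fin n × Fin n)
walkArcs first y [] = [ (y , first) ]
walkArcs first y (z ∷ zs) = (y , z) ∷ walkArcs first z zs

cycleArcs : {n : ℕ} → List (Fin n) → List (Fin n × Fin n)
cycleArcs [] = []
cycleArcs (x ∷ xs) = walkArcs x x xs

IsCycle : {n : ℕ} → BN n → List (Fin n) → Set
IsCycle f c = (c ≢ []) × Unique c × All (λ { (u , v) → Arc f u v }) (cycleArcs c)

cycleSign : {n : ℕ} → Signing n → List (Fin n) → ℤ
cycleSign σ c = foldr _*_ 1ℤ (map (λ { (u , v) → σ u v }) (cycleArcs c))

NonNegCycle : {n : ℕ} → BN n → List (Fin n) → Set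
NonNegCycle f c = IsCycle f c × (0ℤ ≤ℤ cycleSign (sign f) c)

Disjoint : {n : ℕ} → List (Fin n) → List (Fin n) → Set
Disjoint c d = ∀ v → v ∈ c → v ∉ d

IsNuPlus : {n : ℕ} → BN n → ℕ → Set
IsNuPlus {n} f k =
  (Σ (List (List (Fin n))) λ cs → All (NonNegCycle f) cs × AllPairs Disjoint cs × length cs ≡ k)
  × (∀ (cs : List (List (Fin n))) → All (NonNegCycle f) cs → AllPairs Disjoint cs → length cs ≤ k)

IsMonotoneFVS : {n : ℕ} → BN n → Signing n → Subset n → Set
IsMonotoneFVS f σ' J =
  (∀ c → IsCycle f c → Any (_∈ₛ J) c)
  × (∀ u v → Arc f u v → v ∉ₛ J → σ' u v ≡ 1ℤ)

IsTauStarM : {n : ℕ} → BN n → ℕ → Set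
IsTauStarM {n} f t =
  (Σ (Subset n) λ I → Σ (Subset n) λ J → IsMonotoneFVS f (switch I (sign f)) J × ∣ J ∣ ≡ t)
  × (∀ (I J : Subset n) → IsMonotoneFVS f (switch I (sign f)) J → t ≤ ∣ J ∣)

open Sort ≤-decTotalOrder using (sort)

sumLargestBinomials : ℕ → ℕ → ℕ
sumLargestBinomials m t = sum (take m (reverse (sort (map (t C_) (upTo (suc t))))))

-- Fix I and a monotone feedback vertex set J of (G, σ^I), and compare configurations after switching them by I.
-- If two fixed points x, y satisfy x ≤ y on J, they do so everywhere: a vertex where x is 1 and y is 0 has, by a
-- hybrid argument, an in-neighbour of the same kind along an arc whose switched sign is positive (its head is
-- outside J), so such vertices would carry a cycle avoiding J.  Hence restriction to J embeds the fixed points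
-- into {0,1}^τ, reflecting the order.  Two distinct fixed points differ on a non-negative cycle, and along a chain
-- of fixed points these cycles are separated by the chain itself, so chains have at most ν⁺ + 1 elements.
-- Erdős' theorem, proved with a symmetric chain decomposition, bounds such a family by the sum of the ν⁺ + 1
-- largest binomial coefficients (τ choose k).

module Submission where

open import Defs
open import Data.Nat using (ℕ; suc; _≤_; _⊓_)
open import Data.Nat.Properties using (module ≤-Reasoning)
open import Data.Nat.ListAction using (sum)
open import Data.Fin.Subset using (Subset; ∣_∣)
open import Data.List using (map; length)
open import Data.List.Properties using (length-map)
open import Data.Product using (_,_)
open import Relation.Binary.PropositionalEquality using (sym; cong)

module Lists where

  open import Data.Nat using (ℕ; zero; suc; _≤_; _∸_; z≤n; s≤s)
  open import Data.Nat.Properties using (≤-trans; ≤-reflexive)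
  open import Data.List using (List; []; _∷_; [_]; _++_; map; length; applyUpTo; applyDownFrom)
  open import Data.List.Properties using (length-++-sucʳ)
  open import Data.List.Membership.Propositional using (_∈_)
  open import Data.List.Membership.Propositional.Properties using (∈-map⁻; ∈-++⁺ˡ; ∈-++⁺ʳ; ∈-++⁻; ∈-∃++)
  open import Data.List.Relation.Binary.Subset.Propositional using (_⊆_)
  open import Data.List.Relation.Unary.All as All using (All; []; _∷_)
  import Data.List.Relation.Unary.All.Properties as AllP
  open import Data.List.Relation.Unary.Any using (here; there)
  open import Data.List.Relation.Unary.AllPairs using ([]; _∷_)
  open import Data.List.Relation.Unary.Linked using (Linked; []; [-]; _∷_)
  open import Data.List.Relation.Unary.Unique.Propositional using (Unique)
  open import Data.Product using (∃; _×_; _,_)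
  open import Data.Sum using (inj₁; inj₂)
  open import Data.Empty using (⊥-elim)
  open import Relation.Binary.PropositionalEquality hiding ([_])

  Unique⇒length-mono-⊆ : ∀ {A : Set} {xs ys : List A} → Unique xs → xs ⊆ ys → length xs ≤ length ys
  Unique⇒length-mono-⊆ {xs = []}     _             _     = z≤n
  Unique⇒length-mono-⊆ {xs = x ∷ xs} (x∉xs ∷ uniq) xs⊆ys with ∈-∃++ (xs⊆ys (here refl))
  ... | as , bs , refl =
    ≤-trans (s≤s (Unique⇒length-mono-⊆ uniq xs⊆as++bs)) (≤-reflexive (sym (length-++-sucʳ as x bs)))
    where
    xs⊆as++bs : xs ⊆ as ++ bs
    xs⊆as++bs {z} z∈xs with ∈-++⁻ as (xs⊆ys (there z∈xs))
    ... | inj₁ z∈as          = ∈-++⁺ˡ z∈as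
    ... | inj₂ (here refl)   = ⊥-elim (All.lookup x∉xs z∈xs refl)
    ... | inj₂ (there z∈bs) = ∈-++⁺ʳ as z∈bs

  module _ {A : Set} where

    All-prefix : ∀ {P : A → Set} as {w bs} → All P (as ++ w ∷ bs) → All P (as ++ [ w ])
    All-prefix []       (p ∷ _)  = p ∷ []
    All-prefix (a ∷ as) (p ∷ ps) = p ∷ All-prefix as ps

    Unique-prefix : ∀ as {w : A} {bs} → Unique (as ++ w ∷ bs) → Unique (as ++ [ w ])
    Unique-prefix []       _             = [] ∷ []
    Unique-prefix (a ∷ as) (a∉ ∷ uniq) = All-prefix as a∉ ∷ Unique-prefix as uniq

    Linked-prefix : ∀ {R : A → A → Set} a as {w bs} → Linked R (a ∷ as ++ w ∷ bs) → Linked R (a ∷ as ++ [ w ])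
    Linked-prefix a []       (r ∷ _)      = r ∷ [-]
    Linked-prefix a (b ∷ as) (r ∷ linked) = r ∷ Linked-prefix b as linked

  Linked-map-All : ∀ {A : Set} {P : A → Set} {R S : A → A → Set} → (∀ {x y} → P x → P y → R x y → S x y) →
                   ∀ {xs} → All P xs → Linked R xs → Linked S xs
  Linked-map-All R⇒S []           []       = []
  Linked-map-All R⇒S (p ∷ [])     [-]      = [-]
  Linked-map-All R⇒S (p ∷ q ∷ ps) (r ∷ rs) = R⇒S p q r ∷ Linked-map-All R⇒S (q ∷ ps) rs

  module _ {A B : Set} (h : A → B) where

    Unique-map-injective-on : ∀ {xs} → (∀ {x y} → x ∈ xs → y ∈ xs → h x ≡ h y → x ≡ y) →
                              Unique xs → Unique (map h xs)
    Unique-map-injective-on {[]}     _   []            = []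
    Unique-map-injective-on {x ∷ xs} inj (x∉xs ∷ uniq) =
      AllP.map⁺ (All.tabulate (λ y∈xs hx≡hy → All.lookup x∉xs y∈xs (inj (here refl) (there y∈xs) hx≡hy)))
      ∷ Unique-map-injective-on (λ x∈ y∈ → inj (there x∈) (there y∈)) uniq

    All-∈-map⁻ : ∀ {xs ys} → All (_∈ map h xs) ys → ∃ λ zs → All (_∈ xs) zs × map h zs ≡ ys
    All-∈-map⁻ []           = [] , [] , refl
    All-∈-map⁻ (y∈ ∷ ys∈) with ∈-map⁻ h y∈ | All-∈-map⁻ ys∈
    ... | z , z∈xs , refl | zs , zs∈xs , refl = z ∷ zs , z∈xs ∷ zs∈xs , refl

  applyUpTo-cong : ∀ {A : Set} {f g : ℕ → A} → (∀ i → f i ≡ g i) → ∀ k → applyUpTo f k ≡ applyUpTo g k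
  applyUpTo-cong f≡g zero    = refl
  applyUpTo-cong f≡g (suc k) = cong₂ _∷_ (f≡g 0) (applyUpTo-cong (λ i → f≡g (suc i)) k)

  applyDownFrom≡applyUpTo : ∀ {A : Set} (f g : ℕ → A) n → (∀ i → i ≤ n → f (n ∸ i) ≡ g i) →
                            applyDownFrom f (suc n) ≡ applyUpTo g (suc n)
  applyDownFrom≡applyUpTo f g zero    f≡g = cong [_] (f≡g 0 z≤n)
  applyDownFrom≡applyUpTo f g (suc n) f≡g =
    cong₂ _∷_ (f≡g 0 z≤n)
              (applyDownFrom≡applyUpTo f (λ i → g (suc i)) n (λ i i≤n → f≡g (suc i) (s≤s i≤n)))

module BinomialSums where

  open import Data.Bool using (true; false; if_then_else_)
  open import Data.Nat
  open import Data.Nat.Properties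
  open import Data.Nat.Combinatorics using (_C_; nCk≡nC[n∸k]; nCk+nC[k+1]≡[n+1]C[k+1])
  open import Data.Nat.ListAction using (sum)
  open import Data.List using (List; []; _∷_; [_]; _∷ʳ_; map; concatMap; take; reverse; applyUpTo; applyDownFrom; upTo)
  open import Data.List.Properties using (take-[]; applyUpTo-∷ʳ; map-applyUpTo; reverse-applyUpTo; reverse-involutive)
  open import Data.List.Relation.Binary.Permutation.Propositional
    using (_↭_; ↭-refl; ↭-sym; ↭-trans; ↭-reflexive; prep; ↭⇒↭ₛ; module PermutationReasoning)
  open import Data.List.Relation.Binary.Permutation.Propositional.Properties using (∷↭∷ʳ)
  open import Data.List.Relation.Binary.Pointwise using (Pointwise-≡⇒≡)
  open import Data.List.Relation.Unary.Linked using (Linked)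
  open import Data.List.Relation.Unary.Linked.Properties using (applyDownFrom⁺₂)
  open import Data.List.Relation.Unary.Sorted.TotalOrder.Properties using (↗↭↗⇒≋)
  open import Relation.Binary.Bundles using (DecTotalOrder)
  open import Relation.Binary.PropositionalEquality hiding ([_])
  open import Algebra.Properties.CommutativeSemigroup +-commutativeSemigroup using (interchange)
  import Data.List.Sort as Sort
  open Sort ≤-decTotalOrder using (sort; sort-↭; sort-↗)
  open Lists using (applyUpTo-cong; applyDownFrom≡applyUpTo)

  C-sym : ∀ {t} a b → a + b ≡ t → t C a ≡ t C b
  C-sym a b refl = trans (nCk≡nC[n∸k] (m≤m+n a b)) (cong ((a + b) C_) (m+n∸m≡n a b))

  -- A chain of length m + 1 of the cube {0,1}^t splits into chains of lengths m + 2 and m of {0,1}^(t+1).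
  splitLength : ℕ → List ℕ
  splitLength zero    = []
  splitLength (suc m) = suc (suc m) ∷ m ∷ []

  shuffle : ∀ a b c d → a + (b + (c + d)) ≡ (a + c) + (b + d)
  shuffle a b c d = trans (sym (+-assoc a b (c + d))) (interchange a b c d)

  chainLengths : ℕ → List ℕ
  chainLengths zero    = [ 1 ]
  chainLengths (suc t) = concatMap splitLength (chainLengths t)

  𝟙[_<_] : ℕ → ℕ → ℕ
  𝟙[ j < m ] = if j <ᵇ m then 1 else 0

  𝟙-pred : ∀ j m → 𝟙[ j < suc (suc m) ] ≡ 𝟙[ pred j < suc m ]
  𝟙-pred zero    m = refl
  𝟙-pred (suc j) m = refl

  #longer : ℕ → List ℕ → ℕ
  #longer j []      = 0
  #longer j (m ∷ L) = 𝟙[ j < m ] + #longer j L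

  #longer-split : ∀ j L → #longer j (concatMap splitLength L) ≡ #longer (pred j) L + #longer (suc j) L
  #longer-split j []            = refl
  #longer-split j (zero  ∷ L)   = #longer-split j L
  #longer-split j (suc m ∷ L) rewrite #longer-split j L | 𝟙-pred j m =
    shuffle 𝟙[ pred j < suc m ] 𝟙[ j < m ] (#longer (pred j) L) (#longer (suc j) L)

  #longer-antitone : ∀ {j j'} L → j ≤ j' → #longer j' L ≤ #longer j L
  #longer-antitone []      _    = z≤n
  #longer-antitone (m ∷ L) j≤j' = +-mono-≤ (𝟙-antitone _ _ m j≤j') (#longer-antitone L j≤j')
    where
    𝟙-antitone : ∀ j j' m → j ≤ j' → 𝟙[ j' < m ] ≤ 𝟙[ j < m ]
    𝟙-antitone _       _        zero    _         = z≤n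
    𝟙-antitone zero    zero     (suc m) _         = ≤-refl
    𝟙-antitone zero    (suc j') (suc m) _         with j' <ᵇ m
    ... | true  = ≤-refl
    ... | false = z≤n
    𝟙-antitone (suc j) (suc j') (suc m) (s≤s j≤j') = 𝟙-antitone j j' m j≤j'

  #longer-beyond : ∀ t j → t < j → #longer j (chainLengths t) ≡ 0
  #longer-beyond zero    (suc j) _         = refl
  #longer-beyond (suc t) (suc j) (s≤s t<j) =
    trans (#longer-split (suc j) (chainLengths t))
          (cong₂ _+_ (#longer-beyond t j t<j) (#longer-beyond t (suc (suc j)) (m<n⇒m<1+n (m<n⇒m<1+n t<j))))

  C⌈/2⌉≡C[1+⌊/2⌋] : ∀ s → suc s C ⌈ s /2⌉ ≡ suc s C suc ⌊ s /2⌋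
  C⌈/2⌉≡C[1+⌊/2⌋] s = C-sym ⌈ s /2⌉ (suc ⌊ s /2⌋)
    (trans (+-suc ⌈ s /2⌉ ⌊ s /2⌋) (cong suc (trans (+-comm ⌈ s /2⌉ _) (⌊n/2⌋+⌈n/2⌉≡n s))))

  -- #longer-split becomes Pascal's rule.
  #longer-chainLengths : ∀ t i j → i + j ≡ t → #longer j (chainLengths t) ≡ t C ⌊ i /2⌋
  #longer-chainLengths zero zero zero refl = refl
  #longer-chainLengths (suc t) i zero eq =
    trans (#longer-split 0 (chainLengths t))
          (trans (longer-than-0-and-1 t) (cong (λ k → suc t C ⌊ k /2⌋) (sym (trans (sym (+-identityʳ i)) eq))))
    where
    longer-than-0-and-1 : ∀ t → #longer 0 (chainLengths t) + #longer 1 (chainLengths t) ≡ suc t C ⌈ t /2⌉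
    longer-than-0-and-1 zero    = refl
    longer-than-0-and-1 (suc s) = begin
      #longer 0 (chainLengths (suc s)) + #longer 1 (chainLengths (suc s))
        ≡⟨ cong₂ _+_ (#longer-chainLengths (suc s) (suc s) 0 (+-identityʳ (suc s)))
                     (#longer-chainLengths (suc s) s 1 (+-comm s 1)) ⟩
      suc s C ⌈ s /2⌉ + suc s C ⌊ s /2⌋
        ≡⟨ cong (_+ suc s C ⌊ s /2⌋) (C⌈/2⌉≡C[1+⌊/2⌋] s) ⟩
      suc s C suc ⌊ s /2⌋ + suc s C ⌊ s /2⌋
        ≡⟨ +-comm (suc s C suc ⌊ s /2⌋) _ ⟩
      suc s C ⌊ s /2⌋ + suc s C suc ⌊ s /2⌋
        ≡⟨ nCk+nC[k+1]≡[n+1]C[k+1] (suc s) ⌊ s /2⌋ ⟩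
      suc (suc s) C suc ⌊ s /2⌋ ∎
      where open ≡-Reasoning
  #longer-chainLengths (suc t) zero (suc j) refl =
    trans (#longer-split (suc j) (chainLengths j))
          (cong₂ _+_ (#longer-chainLengths j 0 j refl) (#longer-beyond j (suc (suc j)) (m<n⇒m<1+n (n<1+n j))))
  #longer-chainLengths (suc t) (suc zero) (suc j) refl =
    trans (#longer-split (suc j) (chainLengths (suc j)))
          (cong₂ _+_ (#longer-chainLengths (suc j) 1 j refl) (#longer-beyond (suc j) (suc (suc j)) ≤-refl))
  #longer-chainLengths (suc t) (suc (suc i)) (suc j) eq = begin
    #longer (suc j) (chainLengths (suc t))
      ≡⟨ #longer-split (suc j) (chainLengths t) ⟩
    #longer j (chainLengths t) + #longer (suc (suc j)) (chainLengths t)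
      ≡⟨ cong₂ _+_ (#longer-chainLengths t (suc (suc i)) j (trans (cong suc (sym (+-suc i j))) t≡))
                   (#longer-chainLengths t i (suc (suc j)) (trans (+-suc i (suc j)) t≡)) ⟩
    t C suc ⌊ i /2⌋ + t C ⌊ i /2⌋
      ≡⟨ +-comm (t C suc ⌊ i /2⌋) _ ⟩
    t C ⌊ i /2⌋ + t C suc ⌊ i /2⌋
      ≡⟨ nCk+nC[k+1]≡[n+1]C[k+1] t ⌊ i /2⌋ ⟩
    suc t C suc ⌊ i /2⌋ ∎
    where
    open ≡-Reasoning
    t≡ : suc (i + suc j) ≡ t
    t≡ = suc-injective eq

  -- The last entry equals the first by symmetry; move it next to the first and recurse on the middle.
  applyUpTo-↭-halves : ∀ {A : Set} (g : ℕ → A) n → (∀ a b → a + b ≡ n → g a ≡ g b) →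
                       applyUpTo g (suc n) ↭ applyUpTo (λ i → g ⌊ i /2⌋) (suc n)
  applyUpTo-↭-halves g zero          g-sym = ↭-refl
  applyUpTo-↭-halves g (suc zero)    g-sym = prep (g 0) (↭-reflexive (cong [_] (g-sym 1 0 refl)))
  applyUpTo-↭-halves g (suc (suc n)) g-sym = begin
    g 0 ∷ applyUpTo (λ i → g (suc i)) (suc (suc n))
      ≡⟨ cong (g 0 ∷_) (sym (applyUpTo-∷ʳ (λ i → g (suc i)) (suc n))) ⟩
    g 0 ∷ (applyUpTo (λ i → g (suc i)) (suc n) ∷ʳ g (suc (suc n)))
      ↭⟨ prep (g 0) (↭-sym (∷↭∷ʳ (g (suc (suc n))) _)) ⟩
    g 0 ∷ g (suc (suc n)) ∷ applyUpTo (λ i → g (suc i)) (suc n)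
      ≡⟨ cong (λ x → g 0 ∷ x ∷ applyUpTo (λ i → g (suc i)) (suc n)) (g-sym (suc (suc n)) 0 (+-identityʳ _)) ⟩
    g 0 ∷ g 0 ∷ applyUpTo (λ i → g (suc i)) (suc n)
      ↭⟨ prep (g 0) (prep (g 0) (applyUpTo-↭-halves (λ i → g (suc i)) n inner-sym)) ⟩
    g 0 ∷ g 0 ∷ applyUpTo (λ i → g (suc ⌊ i /2⌋)) (suc n) ∎
    where
    open PermutationReasoning
    inner-sym : ∀ a b → a + b ≡ n → g (suc a) ≡ g (suc b)
    inner-sym a b a+b≡n = g-sym (suc a) (suc b) (cong suc (trans (+-suc a b) (cong suc a+b≡n)))

  longerCounts : ℕ → List ℕ
  longerCounts t = applyUpTo (λ j → #longer j (chainLengths t)) (suc t)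

  binomialRow : ℕ → List ℕ
  binomialRow t = map (t C_) (upTo (suc t))

  reverse-longerCounts-↭ : ∀ t → reverse (longerCounts t) ↭ binomialRow t
  reverse-longerCounts-↭ t = begin
    reverse (longerCounts t)
      ≡⟨ reverse-applyUpTo _ (suc t) ⟩
    applyDownFrom (λ j → #longer j (chainLengths t)) (suc t)
      ≡⟨ applyDownFrom≡applyUpTo _ _ t (λ i i≤t → #longer-chainLengths t i (t ∸ i) (m+[n∸m]≡n i≤t)) ⟩
    applyUpTo (λ i → t C ⌊ i /2⌋) (suc t)
      ↭⟨ ↭-sym (applyUpTo-↭-halves (t C_) t C-sym) ⟩
    applyUpTo (t C_) (suc t)
      ≡⟨ sym (map-applyUpTo (λ i → i) (t C_) (suc t)) ⟩
    binomialRow t ∎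
    where open PermutationReasoning

  reverse-longerCounts-↗ : ∀ t → Linked _≤_ (reverse (longerCounts t))
  reverse-longerCounts-↗ t = subst (Linked _≤_) (sym (reverse-applyUpTo _ (suc t)))
    (applyDownFrom⁺₂ _ (suc t) (λ i → #longer-antitone (chainLengths t) (n≤1+n i)))

  reverse-sort-binomialRow : ∀ t → reverse (sort (binomialRow t)) ≡ longerCounts t
  reverse-sort-binomialRow t = begin
    reverse (sort (binomialRow t))
      ≡⟨ cong reverse (Pointwise-≡⇒≡ (↗↭↗⇒≋ (DecTotalOrder.totalOrder ≤-decTotalOrder)
           (sort-↗ (binomialRow t)) (reverse-longerCounts-↗ t)
           (↭⇒↭ₛ (↭-trans (sort-↭ (binomialRow t)) (↭-sym (reverse-longerCounts-↭ t)))))) ⟩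
    reverse (reverse (longerCounts t))
      ≡⟨ reverse-involutive (longerCounts t) ⟩
    longerCounts t ∎
    where open ≡-Reasoning

  #longer-suc : ∀ j L → #longer (suc j) L ≡ #longer j (map pred L)
  #longer-suc j []          = refl
  #longer-suc j (zero  ∷ L) = #longer-suc j L
  #longer-suc j (suc m ∷ L) = cong (𝟙[ j < m ] +_) (#longer-suc j L)

  sum-map-suc⊓ : ∀ k L → sum (map (suc k ⊓_) L) ≡ #longer 0 L + sum (map (k ⊓_) (map pred L))
  sum-map-suc⊓ k []      = refl
  sum-map-suc⊓ k (m ∷ L) = begin
    suc k ⊓ m + sum (map (suc k ⊓_) L)
      ≡⟨ cong₂ _+_ (peel m) (sum-map-suc⊓ k L) ⟩
    (𝟙[ 0 < m ] + k ⊓ pred m) + (#longer 0 L + sum (map (k ⊓_) (map pred L)))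
      ≡⟨ interchange 𝟙[ 0 < m ] _ _ _ ⟩
    (𝟙[ 0 < m ] + #longer 0 L) + (k ⊓ pred m + sum (map (k ⊓_) (map pred L))) ∎
    where
    open ≡-Reasoning
    peel : ∀ m → suc k ⊓ m ≡ 𝟙[ 0 < m ] + k ⊓ pred m
    peel zero    = sym (⊓-zeroʳ k)
    peel (suc m) = refl

  sum-⊓≡sum-#longer : ∀ k L → sum (map (k ⊓_) L) ≡ sum (applyUpTo (λ j → #longer j L) k)
  sum-⊓≡sum-#longer zero    L = sum-map-zero L
    where
    sum-map-zero : ∀ L → sum (map (0 ⊓_) L) ≡ 0
    sum-map-zero []      = refl
    sum-map-zero (_ ∷ L) = sum-map-zero L
  sum-⊓≡sum-#longer (suc k) L = begin
    sum (map (suc k ⊓_) L)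
      ≡⟨ sum-map-suc⊓ k L ⟩
    #longer 0 L + sum (map (k ⊓_) (map pred L))
      ≡⟨ cong (#longer 0 L +_) (sum-⊓≡sum-#longer k (map pred L)) ⟩
    #longer 0 L + sum (applyUpTo (λ j → #longer j (map pred L)) k)
      ≡⟨ cong (λ xs → #longer 0 L + sum xs) (applyUpTo-cong (λ j → sym (#longer-suc j L)) k) ⟩
    #longer 0 L + sum (applyUpTo (λ j → #longer (suc j) L) k) ∎
    where open ≡-Reasoning

  sum-applyUpTo≡sum-take : ∀ (f : ℕ → ℕ) k m → (∀ j → m ≤ j → f j ≡ 0) →
                           sum (applyUpTo f k) ≡ sum (take k (applyUpTo f m))
  sum-applyUpTo≡sum-take f zero    m       f≡0 = refl
  sum-applyUpTo≡sum-take f (suc k) zero    f≡0 =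
    trans (cong₂ _+_ (f≡0 0 z≤n) (sum-applyUpTo≡sum-take (λ i → f (suc i)) k zero (λ j _ → f≡0 (suc j) z≤n)))
          (cong sum (take-[] k))
  sum-applyUpTo≡sum-take f (suc k) (suc m) f≡0 =
    cong (f 0 +_) (sum-applyUpTo≡sum-take (λ i → f (suc i)) k m (λ j m≤j → f≡0 (suc j) (s≤s m≤j)))

  sum-⊓-chainLengths : ∀ k t → sum (map (k ⊓_) (chainLengths t)) ≡ sumLargestBinomials k t
  sum-⊓-chainLengths k t = begin
    sum (map (k ⊓_) (chainLengths t))
      ≡⟨ sum-⊓≡sum-#longer k (chainLengths t) ⟩
    sum (applyUpTo (λ j → #longer j (chainLengths t)) k)
      ≡⟨ sum-applyUpTo≡sum-take _ k (suc t) (λ j t<j → #longer-beyond t j t<j) ⟩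
    sum (take k (longerCounts t))
      ≡⟨ cong (λ xs → sum (take k xs)) (sym (reverse-sort-binomialRow t)) ⟩
    sum (take k (reverse (sort (binomialRow t)))) ∎
    where open ≡-Reasoning

module SymmetricChains where

  open import Data.Bool using (Bool; true; false)
  import Data.Bool as B
  import Data.Bool.Properties as BP
  open import Data.Nat using (ℕ; zero; suc; _+_; _≤_; z≤n; _⊓_)
  open import Data.Nat.Properties using (+-mono-≤; ⊓-glb; module ≤-Reasoning)
  open import Data.Nat.ListAction using (sum)
  open import Data.Vec using (Vec; []; _∷_)
  open import Data.Vec.Properties using (≡-dec; ∷-injective)
  open import Data.Vec.Relation.Binary.Pointwise.Inductive as Pointwise using (Pointwise; []; _∷_)
  open import Data.List using (List; []; _∷_; [_]; _++_; map; concat; concatMap; length; filter)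
  open import Data.List.Properties using (length-map; length-++; filter-++; length-filter)
  open import Data.List.Membership.Propositional using (_∈_)
  open import Data.List.Membership.Propositional.Properties using (∈-map⁺; ∈-filter⁺; ∈-concat⁺′; ∈-concat⁻′)
  import Data.List.Membership.DecPropositional as DecMembership
  open import Data.List.Relation.Unary.All as All using (All; []; _∷_)
  open import Data.List.Relation.Unary.All.Properties using (all-filter; concat⁺; map⁺)
  open import Data.List.Relation.Unary.Any using (here; there)
  open import Data.List.Relation.Unary.Linked as Linked using (Linked; []; [-]; _∷_)
  import Data.List.Relation.Unary.Linked.Properties as Linked
  open import Data.List.Relation.Unary.Unique.Propositional using (Unique)
  open import Data.Product using (_×_; _,_; ∃; proj₂)
  open import Relation.Binary.PropositionalEquality hiding ([_])
  open BinomialSums using (splitLength; chainLengths)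
  open Lists using (Unique⇒length-mono-⊆)

  module _ {t : ℕ} where

    _⊑_ : Vec Bool t → Vec Bool t → Set
    _⊑_ = Pointwise B._≤_

    _⊐_ : Vec Bool t → Vec Bool t → Set
    x ⊐ y = y ⊑ x × y ≢ x

  ⊑-refl : ∀ {t} {x : Vec Bool t} → x ⊑ x
  ⊑-refl = Pointwise.refl BP.≤-refl

  ⊑-antisym : ∀ {t} {x y : Vec Bool t} → x ⊑ y → y ⊑ x → x ≡ y
  ⊑-antisym []       []       = refl
  ⊑-antisym (p ∷ ps) (q ∷ qs) = cong₂ _∷_ (BP.≤-antisym p q) (⊑-antisym ps qs)

  ⊐-trans : ∀ {t} {x y z : Vec Bool t} → x ⊐ y → y ⊐ z → x ⊐ z
  ⊐-trans (y⊑x , y≢x) (z⊑y , z≢y) =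
    Pointwise.trans BP.≤-trans z⊑y y⊑x , λ z≡x → z≢y (⊑-antisym z⊑y (subst (_ ⊑_) (sym z≡x) y⊑x))

  extendChain : ∀ {t} → List (Vec Bool t) → List (List (Vec Bool (suc t)))
  extendChain []           = []
  extendChain (top ∷ rest) = ((true ∷ top) ∷ map (false ∷_) (top ∷ rest)) ∷ map (true ∷_) rest ∷ []

  symmetricChains : (t : ℕ) → List (List (Vec Bool t))
  symmetricChains zero    = [ [ [] ] ]
  symmetricChains (suc t) = concatMap extendChain (symmetricChains t)

  map-length-symmetricChains : ∀ t → map length (symmetricChains t) ≡ chainLengths t
  map-length-symmetricChains zero    = refl
  map-length-symmetricChains (suc t) =
    trans (lengths (symmetricChains t)) (cong (concatMap splitLength) (map-length-symmetricChains t))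
    where
    lengths : ∀ Cs → map length (concatMap extendChain Cs) ≡ concatMap splitLength (map length Cs)
    lengths []                  = refl
    lengths ([] ∷ Cs)           = lengths Cs
    lengths ((top ∷ rest) ∷ Cs) =
      cong₂ _∷_ (cong (λ m → suc (suc m)) (length-map (false ∷_) rest))
                (cong₂ _∷_ (length-map (true ∷_) rest) (lengths Cs))

  map-∷-descending : ∀ {t} b {C : List (Vec Bool t)} → Linked _⊐_ C → Linked _⊐_ (map (b ∷_) C)
  map-∷-descending b []                     = []
  map-∷-descending b [-]                    = [-]
  map-∷-descending b ((y⊑x , y≢x) ∷ linked) =
    (BP.≤-refl ∷ y⊑x , λ e → y≢x (proj₂ (∷-injective e))) ∷ map-∷-descending b linked

  symmetricChains-descending : ∀ t → All (Linked _⊐_) (symmetricChains t)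
  symmetricChains-descending zero    = [-] ∷ []
  symmetricChains-descending (suc t) = concat⁺ (map⁺ (All.map extend (symmetricChains-descending t)))
    where
    extend : ∀ {C} → Linked _⊐_ C → All (Linked _⊐_) (extendChain C)
    extend {[]}         _      = []
    extend {top ∷ rest} linked =
      ((B.f≤t ∷ ⊑-refl , λ ()) ∷ map-∷-descending false linked)
      ∷ map-∷-descending true (Linked.tail linked) ∷ []

  ∈-extendChain : ∀ {t} b (C : List (Vec Bool t)) {x} → x ∈ C → ∃ λ D → (b ∷ x) ∈ D × D ∈ extendChain C
  ∈-extendChain false (top ∷ rest) x∈C            = _ , there (∈-map⁺ (false ∷_) x∈C) , here refl
  ∈-extendChain true  (top ∷ rest) (here refl)    = _ , here refl , here refl
  ∈-extendChain true  (top ∷ rest) (there x∈rest) = _ , ∈-map⁺ (true ∷_) x∈rest , there (here refl)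

  ∈-symmetricChains : ∀ {t} (x : Vec Bool t) → x ∈ concat (symmetricChains t)
  ∈-symmetricChains []      = here refl
  ∈-symmetricChains {suc t} (b ∷ x) with ∈-concat⁻′ (symmetricChains t) (∈-symmetricChains x)
  ... | C , x∈C , C∈chains with ∈-extendChain b C x∈C
  ...   | D , bx∈D , D∈extendC =
    ∈-concat⁺′ bx∈D (∈-concat⁺′ {xss = map extendChain (symmetricChains t)} D∈extendC
                                (∈-map⁺ extendChain C∈chains))

  -- Erdős: a family without chains of length k + 1 meets each chain C of the decomposition
  -- in at most min(k, |C|) points.
  erdős-bound : ∀ {t} k (F : List (Vec Bool t)) → Unique F →
                (∀ ys → All (_∈ F) ys → Linked _⊐_ ys → length ys ≤ k) →
                length F ≤ sum (map (k ⊓_) (chainLengths t))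
  erdős-bound {t} k F uniq chain≤k = begin
    length F
      ≤⟨ Unique⇒length-mono-⊆ uniq (λ {x} x∈F → ∈-filter⁺ (_∈? F) (∈-symmetricChains x) x∈F) ⟩
    length (filter (_∈? F) (concat (symmetricChains t)))
      ≤⟨ traces (symmetricChains-descending t) ⟩
    sum (map (k ⊓_) (map length (symmetricChains t)))
      ≡⟨ cong (λ L → sum (map (k ⊓_) L)) (map-length-symmetricChains t) ⟩
    sum (map (k ⊓_) (chainLengths t)) ∎
    where
    open ≤-Reasoning
    open DecMembership (≡-dec B._≟_) using (_∈?_)
    traces : ∀ {Cs} → All (Linked _⊐_) Cs → length (filter (_∈? F) (concat Cs)) ≤ sum (map (k ⊓_) (map length Cs))
    traces {[]}     []                = z≤n
    traces {C ∷ Cs} (C-chain ∷ chains) = begin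
      length (filter (_∈? F) (C ++ concat Cs))
        ≡⟨ trans (cong length (filter-++ (_∈? F) C (concat Cs))) (length-++ (filter (_∈? F) C)) ⟩
      length (filter (_∈? F) C) + length (filter (_∈? F) (concat Cs))
        ≤⟨ +-mono-≤ (⊓-glb (chain≤k _ (all-filter (_∈? F) C) (Linked.filter⁺ (_∈? F) ⊐-trans C-chain))
                           (length-filter (_∈? F) C))
                    (traces chains) ⟩
      k ⊓ length C + sum (map (k ⊓_) (map length Cs)) ∎

module LocalSigns where

  open import Data.Bool using (Bool; true; false; not; _xor_; if_then_else_)
  import Data.Bool as B
  open import Data.Bool.Properties
    using (¬-not; not-injective; xor-same; xor-inverseˡ; xor-inverseʳ; xor-identityʳ; xor-comm)
  open import Data.Fin using (Fin; zero; suc)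
  open import Data.Vec using ([]; _∷_; lookup; _[_]≔_; _[_]%=_)
  open import Data.Vec.Properties using (updateAt-cong-local; lookup∘update; []≔-idempotent; []≔-lookup)
  open import Data.Integer using (ℤ; 0ℤ; 1ℤ; -_)
  open import Data.Product using (∃; _×_; _,_; proj₁; proj₂)
  open import Data.Sum using (_⊎_; inj₁; inj₂)
  open import Data.Empty using (⊥-elim)
  open import Function using (_∘_)
  open import Relation.Nullary using (yes; no)
  open import Relation.Binary.PropositionalEquality

  -- Walk from x to y changing one coordinate at a time; at the first step where g changes we find u and z.
  hybrid : ∀ {n} (g : Config n → Bool) (x y : Config n) → g x ≢ g y →
           ∃ λ u → ∃ λ z → lookup x u ≢ lookup y u × lookup z u ≡ lookup x u ×
                           g z ≡ g x × g (z [ u ]%= not) ≢ g z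
  hybrid g []      []      gx≢gy = ⊥-elim (gx≢gy refl)
  hybrid g (a ∷ x) (b ∷ y) gx≢gy with g (a ∷ x) B.≟ g (a ∷ y)
  ... | no  ≢tail with hybrid (λ v → g (a ∷ v)) x y ≢tail
  ...   | u , z , x≢y , z≡x , gz≡gx , flip≢ = suc u , a ∷ z , x≢y , z≡x , gz≡gx , flip≢
  hybrid g (a ∷ x) (b ∷ y) gx≢gy | yes ≡tail = zero , a ∷ y , a≢b , refl , sym ≡tail , flip≢
    where
    a≢b : a ≢ b
    a≢b refl = gx≢gy ≡tail
    flip≢ : g (not a ∷ y) ≢ g (a ∷ y)
    flip≢ e = gx≢gy (trans ≡tail (sym (trans (cong (λ c → g (c ∷ y)) (¬-not (a≢b ∘ sym))) e)))

  ≤∧≢⇒ : ∀ {a b : Bool} → a B.≤ b → a ≢ b → a ≡ false × b ≡ true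
  ≤∧≢⇒ B.f≤t _   = refl , refl
  ≤∧≢⇒ B.b≤b a≢a = ⊥-elim (a≢a refl)

  not-antitone : ∀ {a b : Bool} → a B.≤ b → not b B.≤ not a
  not-antitone B.f≤t = B.f≤t
  not-antitone B.b≤b = B.b≤b

  module _ {n} (g : Config n → Bool) (u : Fin n) where

    flip≡update : ∀ z → z [ u ]%= not ≡ z [ u ]≔ not (lookup z u)
    flip≡update z = updateAt-cong-local u z refl

    -- g is 0 at the lower and 1 at the upper end of the u-edge through z.
    increasing-pivot : (∀ x → lookup x u ≡ false → g x B.≤ g (x [ u ]≔ true)) →
                       ∀ z → g (z [ u ]%= not) ≢ g z → lookup z u ≡ g z
    increasing-pivot inc z flip≢ = trans (sym (g-update (lookup z u))) (cong g ([]≔-lookup z u))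
      where
      lo≤hi : g (z [ u ]≔ false) B.≤ g (z [ u ]≔ true)
      lo≤hi = subst (λ v → g (z [ u ]≔ false) B.≤ g v) ([]≔-idempotent z u) (inc _ (lookup∘update u z false))
      ends≢ : ∀ b → g (z [ u ]≔ not b) ≢ g (z [ u ]≔ b) → g (z [ u ]≔ false) ≢ g (z [ u ]≔ true)
      ends≢ false ≢ = ≢ ∘ sym
      ends≢ true  ≢ = ≢
      lo≢hi : g (z [ u ]≔ false) ≢ g (z [ u ]≔ true)
      lo≢hi = ends≢ (lookup z u) (subst₂ (λ v w → g v ≢ g w) (flip≡update z) (sym ([]≔-lookup z u)) flip≢)
      g-update : ∀ b → g (z [ u ]≔ b) ≡ b
      g-update false = proj₁ (≤∧≢⇒ lo≤hi lo≢hi)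
      g-update true  = proj₂ (≤∧≢⇒ lo≤hi lo≢hi)

  decreasing-pivot : ∀ {n} (g : Config n → Bool) u → (∀ x → lookup x u ≡ false → g (x [ u ]≔ true) B.≤ g x) →
                     ∀ z → g (z [ u ]%= not) ≢ g z → lookup z u ≡ not (g z)
  decreasing-pivot g u dec z flip≢ =
    increasing-pivot (not ∘ g) u (λ x x-u → not-antitone (dec x x-u)) z (flip≢ ∘ not-injective)

  module _ {n} (f : BN n) where

    Pivot : Fin n → Fin n → Config n → Set
    Pivot u v z = lookup (f (z [ u ]%= not)) v ≢ lookup (f z) v

    pivot⇒arc : ∀ {u v z} → Pivot u v z → Arc f u v
    pivot⇒arc {z = z} flip≢ = z , flip≢ ∘ sym

    data SignView (u v : Fin n) : ℤ → Set where
      increasing : Increasing f u v → SignView u v 1ℤ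
      decreasing : Decreasing f u v → SignView u v (- 1ℤ)
      neither    : SignView u v 0ℤ

    signView : ∀ u v → SignView u v (sign f u v)
    signView u v with increasing? f u v | decreasing? f u v
    ... | yes inc | _       = increasing inc
    ... | no _    | yes dec = decreasing dec
    ... | no _    | no _    = neither

  ε : Bool → ℤ
  ε b = if b then - 1ℤ else 1ℤ

  pivot-sign : ∀ {n} (f : BN n) {u v z} → Pivot f u v z →
               sign f u v ≡ 0ℤ ⊎ sign f u v ≡ ε (lookup z u xor lookup (f z) v)
  pivot-sign f {u} {v} {z} flip≢ with sign f u v | signView f u v
  ... | _ | increasing inc rewrite increasing-pivot (λ x → lookup (f x) v) u inc z flip≢ =
    inj₂ (cong ε (sym (xor-same (lookup (f z) v))))
  ... | _ | decreasing dec rewrite decreasing-pivot (λ x → lookup (f x) v) u dec z flip≢ =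
    inj₂ (cong ε (sym (xor-inverseˡ (lookup (f z) v))))
  ... | _ | neither = inj₁ refl

  xor-transpose : ∀ a b c d → a xor b ≡ c xor d → a xor c ≡ b xor d
  xor-transpose false b false d e = sym (trans (cong (_xor d) e) (xor-same d))
  xor-transpose false b true  d e = sym (trans (cong (_xor d) e) (xor-inverseˡ d))
  xor-transpose true  b false d e = sym (trans (cong (b xor_) (sym e)) (xor-inverseʳ b))
  xor-transpose true  b true  d e = sym (trans (cong (_xor d) (not-injective e)) (xor-same d))

  xor-cancelʳ : ∀ c {a b} → a xor c ≡ b xor c → a ≡ b
  xor-cancelʳ false {a} {b} e = trans (sym (xor-identityʳ a)) (trans e (xor-identityʳ b))
  xor-cancelʳ true  {a} {b} e = not-injective (trans (sym (xor-comm a true)) (trans e (xor-comm b true)))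

  switch-sign : ∀ c b {s} → s ≡ 0ℤ ⊎ s ≡ ε b → (if c then - s else s) ≡ 1ℤ → c ≡ b
  switch-sign false _     (inj₁ refl) ()
  switch-sign true  _     (inj₁ refl) ()
  switch-sign false false (inj₂ refl) _ = refl
  switch-sign true  true  (inj₂ refl) _ = refl
  switch-sign false true  (inj₂ refl) ()
  switch-sign true  false (inj₂ refl) ()

  -- Switching the signs by I is the same as relabelling every x_w by x_w xor I_w.
  switch-positive-pivot : ∀ {n} (f : BN n) I {u v z} → switch I (sign f) u v ≡ 1ℤ → Pivot f u v z →
                          lookup z u xor lookup I u ≡ lookup (f z) v xor lookup I v
  switch-positive-pivot f I {u} {v} {z} positive flip≢ =
    xor-transpose (lookup z u) (lookup (f z) v) (lookup I u) (lookup I v)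
                  (sym (switch-sign (lookup I u xor lookup I v) _ (pivot-sign f flip≢) positive))

module Cycles where

  open import Data.Nat using (zero; suc; _+_; _≤_)
  open import Data.Nat.Properties using (+-suc; +-identityʳ; ≤-trans; ≤-reflexive; 1+n≰n)
  open import Data.Fin using (Fin)
  import Data.Fin.Properties as Fin
  open import Data.List using (List; []; _∷_; [_]; _++_; length)
  open import Data.List.Properties using (length-tabulate)
  open import Data.List.Membership.Propositional using (_∈_)
  open import Data.List.Membership.Propositional.Properties using (∈-∃++; ∈-allFin)
  import Data.List.Membership.DecPropositional as DecMembership
  open import Data.List.Relation.Unary.All as All using (All; []; _∷_)
  open import Data.List.Relation.Unary.All.Properties using (¬Any⇒All¬)
  open import Data.List.Relation.Unary.Linked using (Linked; []; [-]; _∷_)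
  open import Data.List.Relation.Unary.Unique.Propositional using (Unique)
  open import Data.List.Relation.Unary.AllPairs using ([]; _∷_)
  open import Data.Product using (∃; _×_; _,_)
  open import Data.Empty using (⊥-elim)
  open import Relation.Nullary using (yes; no)
  open import Relation.Binary.PropositionalEquality hiding ([_])
  open Lists using (Unique⇒length-mono-⊆; All-prefix; Unique-prefix; Linked-prefix)

  Unique⇒length≤ : ∀ {n} {xs : List (Fin n)} → Unique xs → length xs ≤ n
  Unique⇒length≤ {n} uniq =
    ≤-trans (Unique⇒length-mono-⊆ uniq (λ {x} _ → ∈-allFin x)) (≤-reflexive (length-tabulate (λ i → i)))

  module CycleWithin {n} (P : Fin n → Set) (R : Fin n → Fin n → Set)
                     (predecessor : ∀ {w} → P w → ∃ λ u → P u × R u w) where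

    Cycle : Set
    Cycle = ∃ λ c → c ≢ [] × Unique c × All P c × All (λ { (u , v) → R u v }) (cycleArcs c)

    walkArcs-closed : ∀ {first} y zs {w} → Linked R (y ∷ zs ++ [ w ]) → R w first →
                      All (λ { (u , v) → R u v }) (walkArcs first y (zs ++ [ w ]))
    walkArcs-closed y []       (r ∷ _)      r′ = r ∷ r′ ∷ []
    walkArcs-closed y (z ∷ zs) (r ∷ linked) r′ = r ∷ walkArcs-closed z zs linked r′

    close : ∀ {h rest w} → Unique (h ∷ rest) → All P (h ∷ rest) → Linked R (h ∷ rest) →
            R w h → w ∈ h ∷ rest → Cycle
    close uniq all linked r w∈path with ∈-∃++ w∈path
    ... | []     , _ , refl = _ , (λ ()) , [] ∷ [] , All.head all ∷ [] , r ∷ []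
    ... | a ∷ as , _ , refl =
      a ∷ as ++ [ _ ] , (λ ()) , Unique-prefix (a ∷ as) uniq , All-prefix (a ∷ as) all ,
      walkArcs-closed a as (Linked-prefix a as linked) r

    open DecMembership (Fin._≟_ {n}) using (_∈?_)

    -- The simple path h ∷ rest grows backwards from h; the fuel runs out only when it would have n + 1 vertices.
    grow : ∀ fuel h rest → length rest + fuel ≡ n →
           Unique (h ∷ rest) → All P (h ∷ rest) → Linked R (h ∷ rest) → Cycle
    grow zero h rest len uniq _ _ =
      ⊥-elim (1+n≰n (≤-trans (Unique⇒length≤ uniq)
                             (≤-reflexive (trans (sym len) (+-identityʳ (length rest))))))
    grow (suc fuel) h rest len uniq all linked with predecessor (All.head all)
    ... | w , pw , r with w ∈? h ∷ rest
    ...   | yes w∈path = close uniq all linked r w∈path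
    ...   | no  w∉path =
      grow fuel w (h ∷ rest) (trans (sym (+-suc (length rest) fuel)) len)
           (¬Any⇒All¬ (h ∷ rest) w∉path ∷ uniq) (pw ∷ all) (r ∷ linked)

    cycle-within : ∀ {v} → P v → Cycle
    cycle-within {v} pv = grow n v [] refl ([] ∷ []) (pv ∷ []) [-]

module Configurations where

  open import Data.Bool using (Bool; true; false)
  import Data.Bool as B
  open import Data.Nat using (zero; suc)
  open import Data.Fin using (Fin; zero; suc)
  open import Data.Fin.Subset using (Subset; ∣_∣) renaming (_∈_ to _∈ₛ_)
  open import Data.Vec using (Vec; []; _∷_; lookup)
  import Data.Vec as V
  open import Data.Vec.Properties using (∷-injective; tabulate∘lookup; tabulate-cong)
  open import Data.Vec.Relation.Binary.Pointwise.Inductive using (_∷_)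
  open import Data.List using (map)
  open import Data.List.Membership.Propositional using (_∈_)
  open import Data.List.Membership.Propositional.Properties using (∈-map⁻)
  open import Data.List.Relation.Unary.All using ([])
  open import Data.List.Relation.Unary.AllPairs using ([]; _∷_)
  open import Data.List.Relation.Unary.Unique.Propositional using (Unique)
  import Data.List.Relation.Unary.Unique.Propositional.Properties as Unique
  open import Data.Product using (∃; _×_; _,_; proj₂)
  open import Data.Empty using (⊥; ⊥-elim)
  open import Function using (_∘_)
  open import Relation.Nullary using (yes; no)
  open import Relation.Binary.PropositionalEquality
  open SymmetricChains using (_⊑_)

  lookup-differs : ∀ {n} {x y : Vec Bool n} → x ≢ y → ∃ λ w → lookup x w ≢ lookup y w
  lookup-differs {x = []}    {[]}    x≢y = ⊥-elim (x≢y refl)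
  lookup-differs {x = a ∷ x} {b ∷ y} x≢y with a B.≟ b
  ... | no a≢b = zero , a≢b
  ... | yes refl with lookup-differs (x≢y ∘ cong (a ∷_))
  ...   | w , x≢y′ = suc w , x≢y′

  lookup-ext : ∀ {n} {x y : Vec Bool n} → (∀ w → lookup x w ≡ lookup y w) → x ≡ y
  lookup-ext {x = x} {y} x≗y = trans (sym (tabulate∘lookup x)) (trans (tabulate-cong x≗y) (tabulate∘lookup y))

  allConfigs-unique : ∀ n → Unique (allConfigs n)
  allConfigs-unique zero    = [] ∷ []
  allConfigs-unique (suc n) =
    Unique.++⁺ (Unique.map⁺ (proj₂ ∘ ∷-injective) (allConfigs-unique n))
               (Unique.map⁺ (proj₂ ∘ ∷-injective) (allConfigs-unique n))
               different-heads
    where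
    different-heads : ∀ {v} → v ∈ map (false ∷_) (allConfigs n) × v ∈ map (true ∷_) (allConfigs n) → ⊥
    different-heads (v∈0s , v∈1s) with ∈-map⁻ (false ∷_) v∈0s | ∈-map⁻ (true ∷_) v∈1s
    ... | _ , _ , refl | _ , _ , ()

  restrict : ∀ {n} {A : Set} (J : Subset n) → (Fin n → A) → Vec A ∣ J ∣
  restrict []          g = []
  restrict (true ∷ J)  g = g zero ∷ restrict J (g ∘ suc)
  restrict (false ∷ J) g = restrict J (g ∘ suc)

  restrict-⊑ : ∀ {n} (J : Subset n) {g g′ : Fin n → Bool} → restrict J g ⊑ restrict J g′ →
               ∀ {w} → w ∈ₛ J → g w B.≤ g′ w
  restrict-⊑ (true ∷ J)  (p ∷ _)  V.here        = p
  restrict-⊑ (true ∷ J)  (_ ∷ ps) (V.there w∈J) = restrict-⊑ J ps w∈J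
  restrict-⊑ (false ∷ J) ps       (V.there w∈J) = restrict-⊑ J ps w∈J

module FixedPointCycles where

  open import Data.Bool using (Bool; true; false; not; _xor_)
  import Data.Bool as B
  open import Data.Bool.Properties using (¬-not; not-¬; not-distribˡ-xor; xor-same)
  open import Data.Nat using (suc; _≤_; z≤n; s≤s)
  open import Data.Fin using (Fin)
  open import Data.Fin.Subset using (Subset) renaming (_∈_ to _∈ₛ_; _∉_ to _∉ₛ_)
  open import Data.Vec using (lookup)
  open import Data.Integer using (ℤ; 0ℤ; 1ℤ; _*_; +≤+) renaming (_≤_ to _≤ℤ_)
  open import Data.Integer.Properties using (*-identityʳ; *-zeroʳ)
  open import Data.List using (List; []; _∷_; length; foldr; map)
  open import Data.List.Relation.Unary.All as All using (All; []; _∷_)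
  open import Data.List.Relation.Unary.AllPairs using (AllPairs; []; _∷_)
  open import Data.List.Relation.Unary.Linked using (Linked; []; _∷_)
  open import Data.Product using (∃; _×_; _,_; proj₁; proj₂)
  open import Data.Sum using (_⊎_; inj₁; inj₂)
  open import Data.Empty using (⊥-elim)
  open import Function using (_∘_)
  open import Relation.Binary.PropositionalEquality
  open LocalSigns using (hybrid; ≤∧≢⇒; Pivot; pivot⇒arc; ε; pivot-sign; switch-positive-pivot)
  open Cycles using (module CycleWithin)
  open Configurations using (lookup-differs)

  -- Products of signs of the form ε(b u xor b v) telescope along a walk.
  module _ {n} (σ : Signing n) (b : Fin n → Bool) where

    Balanced : Fin n × Fin n → Set
    Balanced (u , v) = σ u v ≡ 0ℤ ⊎ σ u v ≡ ε (b u xor b v)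

    arcProduct : List (Fin n × Fin n) → ℤ
    arcProduct as = foldr _*_ 1ℤ (map (λ { (u , v) → σ u v }) as)

    walk-sign : ∀ first y zs → All Balanced (walkArcs first y zs) →
                arcProduct (walkArcs first y zs) ≡ 0ℤ ⊎ arcProduct (walkArcs first y zs) ≡ ε (b y xor b first)
    walk-sign first y []       (inj₁ s≡0 ∷ []) = inj₁ (trans (*-identityʳ _) s≡0)
    walk-sign first y []       (inj₂ s≡ε ∷ []) = inj₂ (trans (*-identityʳ _) s≡ε)
    walk-sign first y (z ∷ zs) (inj₁ s≡0 ∷ balanced) = inj₁ (cong (_* arcProduct (walkArcs first z zs)) s≡0)
    walk-sign first y (z ∷ zs) (inj₂ s≡ε ∷ balanced) with walk-sign first z zs balanced
    ... | inj₁ rest≡0 = inj₁ (trans (cong (σ y z *_) rest≡0) (*-zeroʳ (σ y z)))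
    ... | inj₂ rest≡ε = inj₂ (trans (cong₂ _*_ s≡ε rest≡ε) (ε-telescope (b y) (b z) (b first)))
      where
      ε-telescope : ∀ a b c → ε (a xor b) * ε (b xor c) ≡ ε (a xor c)
      ε-telescope false false false = refl
      ε-telescope false false true  = refl
      ε-telescope false true  false = refl
      ε-telescope false true  true  = refl
      ε-telescope true  false false = refl
      ε-telescope true  false true  = refl
      ε-telescope true  true  false = refl
      ε-telescope true  true  true  = refl

    balanced-cycle-nonneg : ∀ c → All Balanced (cycleArcs c) → 0ℤ ≤ℤ cycleSign σ c
    balanced-cycle-nonneg []      _        = +≤+ z≤n
    balanced-cycle-nonneg (h ∷ t) balanced with walk-sign h h t balanced
    ... | inj₁ s≡0 = subst (0ℤ ≤ℤ_) (sym s≡0) (+≤+ z≤n)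
    ... | inj₂ s≡ε = subst (0ℤ ≤ℤ_) (sym (trans s≡ε (cong ε (xor-same (b h))))) (+≤+ z≤n)

  module FixedPoints {n} (f : BN n) where

    Fixed : Config n → Set
    Fixed x = f x ≡ x

    fixed-lookup : ∀ {z} → Fixed z → ∀ w → lookup (f z) w ≡ lookup z w
    fixed-lookup fix-z w = cong (λ v → lookup v w) fix-z

    module _ {x y} (fix-x : Fixed x) (fix-y : Fixed y) where

      disagreement-predecessor : ∀ {w} → lookup x w ≢ lookup y w →
        ∃ λ u → lookup x u ≢ lookup y u ×
                ∃ λ z → Pivot f u w z × lookup z u ≡ lookup x u × lookup (f z) w ≡ lookup x w
      disagreement-predecessor {w} xw≢yw
        with hybrid (λ c → lookup (f c) w) x y
                    (λ e → xw≢yw (trans (sym (fixed-lookup fix-x w)) (trans e (fixed-lookup fix-y w))))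
      ... | u , z , xu≢yu , zu≡xu , fz≡fx , flip≢ =
        u , xu≢yu , z , flip≢ , zu≡xu , trans fz≡fx (fixed-lookup fix-x w)

      nonneg-cycle-between : x ≢ y → ∃ λ c → NonNegCycle f c × All (λ w → lookup x w ≢ lookup y w) c
      nonneg-cycle-between x≢y =
        let c , c≢[] , uniq , differ , arcs = cycle-within (proj₂ (lookup-differs x≢y))
            nonneg = balanced-cycle-nonneg (sign f) (lookup x) c (All.map proj₂ arcs)
        in c , ((c≢[] , uniq , All.map proj₁ arcs) , nonneg) , differ
        where
        BalancedArc : Fin n → Fin n → Set
        BalancedArc u w = Arc f u w × Balanced (sign f) (lookup x) (u , w)

        predecessor : ∀ {w} → lookup x w ≢ lookup y w → ∃ λ u → lookup x u ≢ lookup y u × BalancedArc u w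
        predecessor xw≢yw with disagreement-predecessor xw≢yw
        ... | u , xu≢yu , z , flip≢ , zu≡xu , fz≡xw =
          u , xu≢yu , pivot⇒arc f flip≢ ,
          subst₂ (λ a c → sign f u _ ≡ 0ℤ ⊎ sign f u _ ≡ ε (a xor c)) zu≡xu fz≡xw (pivot-sign f flip≢)

        open CycleWithin (λ w → lookup x w ≢ lookup y w) BalancedArc predecessor

    module Switched (I J : Subset n) (mfvs : IsMonotoneFVS f (switch I (sign f)) J) where

      switched : Config n → Fin n → Bool
      switched x w = lookup x w xor lookup I w

      switched-disagree : ∀ x y {w} → lookup x w ≢ lookup y w → switched y w ≡ not (switched x w)
      switched-disagree x y {w} x≢y =
        trans (cong (_xor lookup I w) (¬-not (x≢y ∘ sym))) (sym (not-distribˡ-xor (lookup x w) (lookup I w)))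

      -- Otherwise the vertices where x is above y carry a cycle avoiding J.
      switched-monotone : ∀ {x y} → Fixed x → Fixed y → (∀ {w} → w ∈ₛ J → switched x w B.≤ switched y w) →
                          ∀ w → switched x w B.≤ switched y w
      switched-monotone {x} {y} fix-x fix-y ≤-on-J w with switched x w in sx | switched y w in sy
      ... | false | false = B.b≤b
      ... | false | true  = B.f≤t
      ... | true  | true  = B.b≤b
      ... | true  | false =
        let c , c≢[] , uniq , inverted , arcs = cycle-within (sx , sy)
        in ⊥-elim (All.lookupWith inverted⇒∉J inverted (proj₁ mfvs c (c≢[] , uniq , arcs)))
        where
        Inverted : Fin n → Set
        Inverted w = switched x w ≡ true × switched y w ≡ false

        inverted⇒∉J : ∀ {w} → Inverted w → w ∉ₛ J
        inverted⇒∉J (sx , sy) w∈J with subst₂ B._≤_ sx sy (≤-on-J w∈J)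
        ... | ()

        inverted⇒≢ : ∀ {w} → Inverted w → lookup x w ≢ lookup y w
        inverted⇒≢ {w} (sx , sy) e with trans (sym sx) (trans (cong (_xor lookup I w) e) sy)
        ... | ()

        predecessor : ∀ {w} → Inverted w → ∃ λ u → Inverted u × Arc f u w
        predecessor {w} inv with disagreement-predecessor fix-x fix-y (inverted⇒≢ inv)
        ... | u , xu≢yu , z , flip≢ , zu≡xu , fz≡xw = u , (sxu , syu) , arc
          where
          arc : Arc f u w
          arc = pivot⇒arc f flip≢
          sxu : switched x u ≡ true
          sxu = trans (subst₂ (λ a c → a xor lookup I u ≡ c xor lookup I w) zu≡xu fz≡xw
                        (switch-positive-pivot f I (proj₂ mfvs u w arc (inverted⇒∉J inv)) flip≢)) (proj₁ inv)
          syu : switched y u ≡ false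
          syu = trans (switched-disagree x y xu≢yu) (cong not sxu)

        open CycleWithin Inverted (Arc f) predecessor

      _≻_ : Config n → Config n → Set
      x ≻ y = (∀ w → switched y w B.≤ switched x w) × x ≢ y

      Above : Config n → List (Fin n) → Set
      Above x = All (λ w → switched x w ≡ true)

      -- The cycle between consecutive members lies where the upper one is 1 and the lower one 0,
      -- so these cycles are disjoint.
      chain⇒disjoint-cycles : ∀ {x ys} → Fixed x → All Fixed ys → Linked _≻_ (x ∷ ys) →
        ∃ λ cs → length cs ≡ length ys × All (NonNegCycle f) cs × AllPairs Disjoint cs × All (Above x) cs
      chain⇒disjoint-cycles {ys = []}    _     []             _                  = [] , refl , [] , [] , []
      chain⇒disjoint-cycles {x} {y ∷ ys} fix-x (fix-y ∷ fixes) ((y≤x , x≢y) ∷ chain)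
        with chain⇒disjoint-cycles fix-y fixes chain | nonneg-cycle-between fix-x fix-y x≢y
      ... | cs , len , nonneg , disjoint , above | c , c-nonneg , differ =
        c ∷ cs , cong suc len , c-nonneg ∷ nonneg , All.map disjoint-from-c above ∷ disjoint ,
        All.map proj₂ separated ∷ All.map (All.map raise) above
        where
        separated : All (λ w → switched y w ≡ false × switched x w ≡ true) c
        separated = All.map (λ {w} xw≢yw → ≤∧≢⇒ (y≤x w) (λ e → not-¬ refl (trans (sym e) (switched-disagree x y xw≢yw))))
                            differ
        raise : ∀ {w} → switched y w ≡ true → switched x w ≡ true
        raise {w} = true-≤ (y≤x w)
          where
          true-≤ : ∀ {a b} → a B.≤ b → a ≡ true → b ≡ true
          true-≤ B.b≤b a≡true = a≡true
          true-≤ B.f≤t _      = refl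
        disjoint-from-c : ∀ {d} → Above y d → Disjoint c d
        disjoint-from-c above-y v v∈c v∈d
          with trans (sym (proj₁ (All.lookup separated v∈c))) (All.lookup above-y v∈d)
        ... | ()

      switched-chain-bound : ∀ {ν xs} → (∀ cs → All (NonNegCycle f) cs → AllPairs Disjoint cs → length cs ≤ ν) →
                             All Fixed xs → Linked _≻_ xs → length xs ≤ suc ν
      switched-chain-bound {xs = []}     _          _               _     = z≤n
      switched-chain-bound {xs = x ∷ xs} ν-maximal (fix-x ∷ fixes) chain =
        let cs , len , nonneg , disjoint , _ = chain⇒disjoint-cycles fix-x fixes chain
        in s≤s (subst (_≤ _) len (ν-maximal cs nonneg disjoint))

module Encoding {n} (f : BN n) (I J : Subset n) (mfvs : IsMonotoneFVS f (switch I (sign f)) J) where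

  open import Data.Bool using (Bool)
  import Data.Bool as B
  import Data.Bool.Properties as BP
  open import Data.Nat using (suc; _≤_)
  open import Data.Vec using (Vec; lookup)
  open import Data.Vec.Properties using (≡-dec)
  open import Data.List using (List; map; filter; length)
  open import Data.List.Properties using (length-map)
  open import Data.List.Membership.Propositional using (_∈_)
  open import Data.List.Membership.Propositional.Properties using (∈-filter⁻)
  open import Data.List.Relation.Unary.All as All using (All)
  open import Data.List.Relation.Unary.AllPairs using (AllPairs)
  open import Data.List.Relation.Unary.Linked using (Linked)
  import Data.List.Relation.Unary.Linked.Properties as Linked
  open import Data.List.Relation.Unary.Unique.Propositional using (Unique)
  import Data.List.Relation.Unary.Unique.Propositional.Properties as Unique
  open import Data.Product using (_,_; proj₂)
  open import Function using (_∘_)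
  open import Relation.Binary.PropositionalEquality using (_≡_; refl; sym; cong; subst)
  open Lists using (Linked-map-All; Unique-map-injective-on; All-∈-map⁻)
  open SymmetricChains using (_⊑_; _⊐_; ⊑-refl)
  open LocalSigns using (xor-cancelʳ)
  open Configurations using (lookup-ext; allConfigs-unique; restrict; restrict-⊑)
  open FixedPointCycles.FixedPoints f
  open Switched I J mfvs

  fixedPoints : List (Config n)
  fixedPoints = filter (λ x → ≡-dec B._≟_ (f x) x) (allConfigs n)

  fixed : ∀ {x} → x ∈ fixedPoints → Fixed x
  fixed = proj₂ ∘ ∈-filter⁻ (λ x → ≡-dec B._≟_ (f x) x) {xs = allConfigs n}

  code : Config n → Vec Bool ∣ J ∣
  code x = restrict J (switched x)

  code-reflects : ∀ {x y} → Fixed x → Fixed y → code x ⊑ code y → ∀ w → switched x w B.≤ switched y w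
  code-reflects fix-x fix-y x⊑y = switched-monotone fix-x fix-y (restrict-⊑ J x⊑y)

  codes-unique : Unique (map code fixedPoints)
  codes-unique = Unique-map-injective-on code injective (Unique.filter⁺ _ (allConfigs-unique n))
    where
    injective : ∀ {x y} → x ∈ fixedPoints → y ∈ fixedPoints → code x ≡ code y → x ≡ y
    injective {x} {y} x∈ y∈ e = lookup-ext λ w → xor-cancelʳ (lookup I w)
      (BP.≤-antisym (code-reflects (fixed x∈) (fixed y∈) (subst (code x ⊑_) e ⊑-refl) w)
                    (code-reflects (fixed y∈) (fixed x∈) (subst (code y ⊑_) (sym e) ⊑-refl) w))

  code-chain-bound : ∀ {ν} → (∀ cs → All (NonNegCycle f) cs → AllPairs Disjoint cs → length cs ≤ ν) →
                     ∀ ys → All (_∈ map code fixedPoints) ys → Linked _⊐_ ys → length ys ≤ suc ν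
  code-chain-bound {ν} ν-maximal ys ys∈ chain with All-∈-map⁻ code ys∈
  ... | xs , xs∈ , refl = subst (_≤ suc ν) (sym (length-map code xs))
    (switched-chain-bound ν-maximal (All.map fixed xs∈)
      (Linked-map-All (λ fix-x fix-y (y⊑x , y≢x) → code-reflects fix-y fix-x y⊑x , y≢x ∘ cong code ∘ sym)
                      (All.map fixed xs∈) (Linked.map⁻ chain)))

open BinomialSums using (chainLengths; sum-⊓-chainLengths)
open SymmetricChains using (erdős-bound)

theorem5 : (n : ℕ) (f : BN n) (ν τ : ℕ) → IsNuPlus f ν → IsTauStarM f τ →
    numFixedPoints f ≤ sumLargestBinomials (suc ν) τ
theorem5 n f ν τ (_ , ν-maximal) ((I , J , mfvs , |J|≡τ) , _) = begin
  numFixedPoints f                          ≡⟨ sym (length-map code fixedPoints) ⟩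
  length (map code fixedPoints)             ≤⟨ erdős-bound (suc ν) _ codes-unique (code-chain-bound ν-maximal) ⟩
  sum (map (suc ν ⊓_) (chainLengths ∣ J ∣)) ≡⟨ sum-⊓-chainLengths (suc ν) ∣ J ∣ ⟩
  sumLargestBinomials (suc ν) ∣ J ∣         ≡⟨ cong (sumLargestBinomials (suc ν)) |J|≡τ ⟩
  sumLargestBinomials (suc ν) τ             ∎
  where
  open ≤-Reasoning
  open Encoding f I J mfvs
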